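{- Let $n\ge 2$ and $k\ge 0$, and let $D$ be the weighted strand diagram consisting of a single crossing of size $n$ with no dots. Then \[ \operatorname{tr}^{\,n-1}(\partial_kD)=(n-2)!\sum_{j=0}^{k}h_{k-j}\left[\sum_{i=2}^{n}(i-1)h_{n-i}S^{i+j-1}+\sum_{i=1}^{n-1}\sum_{\ell=1}^{n-i}h_{n-\ell-i}\,p_{\ell+j}\,S^{i-1}\right]. \]
   Context: Let $\Lambda$ be the ring of symmetric functions, $h_m$ the complete homogeneous symmetric functions ($h_0=1$) and $p_m$ the power sum symmetric functions. A weighted crossing of size $m\ge1$ is a tuple $(a_1,\dots,a_m)$ of nonnegative integers, thought of as a single crossing of $m$ strands with $a_i$ dots decorating the top of strand $i$; for $m=1$ it is a single strand with $a_1$ dots, denoted $S^{a_1}$. We work in the free $\Lambda$-module with basis the weighted crossings. The trace $\operatorname{tr}$ is the $\Lambda$-linear map defined on a weighted crossing of size $m\ge2$ by \[\operatorname{tr}(a_1,\dots,a_m)=p_{a_m+1}(a_1,\dots,a_{m-1})+\sum_{i=1}^{m-1}(a_1,\dots,a_i+a_m+1,\dots,a_{m-1}),\] i.e. the last strand is removed and either a factor $p_{a_m+1}$ is introduced or $a_m+1$ dots are added to one of the remaining strands. $\operatorname{tr}^{n-1}$ is the $(n-1)$-fold iterate. For a weighted diagram $D$, $D^j$ denotes $D$ with $j$ extra dots on its right-most strand, and $\partial_kD=\sum_{j=0}^{k}h_{k-j}D^j$. -}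

module Defs where

open import Level using (Level)
open import Algebra.Bundles using (CommutativeRing)
open import Data.Nat using (ℕ; zero; suc; _+_; _∸_; _!)
open import Data.Nat.Properties using (_≟_)
open import Data.List using (List; []; _∷_; _++_; map; concat; foldr; upTo)
open import Data.List.Properties using (≡-dec)
open import Data.Maybe using (Maybe; just; nothing)
open import Data.Product using (_×_; _,_)
open import Relation.Nullary using (yes; no)

-- The weighted crossing (a₁,…,aₘ) is represented by the list [a₁,…,aₘ].
Crossing : Set
Crossing = List ℕ

range : ℕ → ℕ → List ℕ
range lo hi = map (lo +_) (upTo (suc hi ∸ lo))

unsnoc : List ℕ → Maybe (List ℕ × ℕ)
unsnoc [] = nothing
unsnoc (x ∷ []) = just ([] , x)
unsnoc (x ∷ y ∷ xs) with unsnoc (y ∷ xs)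
... | just (ys , z) = just (x ∷ ys , z)
... | nothing = nothing

bumps : ℕ → List ℕ → List (List ℕ)
bumps d [] = []
bumps d (x ∷ xs) = (x + d ∷ xs) ∷ map (x ∷_) (bumps d xs)

-- Everything relative to a commutative ring R (playing the role of Λ)
-- equipped with families h, p : ℕ → R.
module Sym {c ℓ : Level} (R : CommutativeRing c ℓ)
           (h p : ℕ → CommutativeRing.Carrier R) where
  open CommutativeRing R renaming (_+_ to _+R_; _*_ to _*R_)

  natR : ℕ → Carrier
  natR zero = 0#
  natR (suc m) = 1# +R natR m

  ΣR : List ℕ → (ℕ → Carrier) → Carrier
  ΣR is f = foldr (λ i acc → f i +R acc) 0# is

  Newton : ℕ → Set ℓ
  Newton m = natR m *R h m ≈ ΣR (range 1 m) (λ i → p i *R h (m ∸ i))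

  -- Elements of the free R-module on weighted crossings, as formal
  -- finite sums  Σ r · D.
  FS : Set c
  FS = List (Carrier × Crossing)

  coeff : FS → Crossing → Carrier
  coeff [] D = 0#
  coeff ((r , E) ∷ xs) D with ≡-dec _≟_ E D
  ... | yes _ = r +R coeff xs D
  ... | no _ = coeff xs D

  infix 4 _≋_
  _≋_ : FS → FS → Set ℓ
  x ≋ y = ∀ D → coeff x D ≈ coeff y D

  scale : Carrier → FS → FS
  scale r = map (λ { (s , D) → (r *R s , D) })

  ΣFS : List ℕ → (ℕ → FS) → FS
  ΣFS is f = concat (map f is)

  -- trace of a single weighted crossing of size m ≥ 2:
  -- tr(a₁,…,aₘ) = p_{aₘ+1}(a₁,…,a_{m-1}) + Σᵢ (a₁,…,aᵢ+aₘ+1,…,a_{m-1});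
  -- (not used on size ≤ 1; set to 0 there)
  tr₁ : Crossing → FS
  tr₁ D with unsnoc D
  ... | just ([] , a) = []
  ... | just (ys@(_ ∷ _) , a) =
        (p (suc a) , ys) ∷ map (λ E → (1# , E)) (bumps (suc a) ys)
  ... | nothing = []

  tr : FS → FS
  tr [] = []
  tr ((r , D) ∷ xs) = scale r (tr₁ D) ++ tr xs

  trIter : ℕ → FS → FS
  trIter zero x = x
  trIter (suc m) x = tr (trIter m x)

  -- single strand with a dots
  S : ℕ → Crossing
  S a = a ∷ []

  -- D^j for D the dotless crossing of size n: j dots on the rightmost strand
  Dj : ℕ → ℕ → Crossing
  Dj zero j = []
  Dj (suc zero) j = j ∷ []
  Dj (suc (suc m)) j = 0 ∷ Dj (suc m) j

  ∂D : ℕ → ℕ → FS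
  ∂D n k = ΣFS (range 0 k) (λ j → (h (k ∸ j) , Dj n j) ∷ [])

  RHS : ℕ → ℕ → FS
  RHS n k = scale (natR ((n ∸ 2) !))
    (ΣFS (range 0 k) λ j → scale (h (k ∸ j))
      (ΣFS (range 2 n) (λ i → (natR (i ∸ 1) *R h (n ∸ i) , S (i + j ∸ 1)) ∷ [])
       ++ ΣFS (range 1 (n ∸ 1)) (λ i → ΣFS (range 1 (n ∸ i)) (λ l →
            (h (n ∸ l ∸ i) *R p (l + j) , S (i ∸ 1)) ∷ []))))

{-# OPTIONS --safe #-}
module Submission where

-- Coefficients are read off by pairing with indicator functionals δ E, and pairing with tr x is
-- pairing x with the transposed functional T φ.  So the coefficient of E in tr^(n-1) (D^j) is
-- (T^(n-1) δ_E)(0,…,0,j), which only depends on the values f a = δ_E (S^a).  The functionals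
-- ψ_m = T^m (S^a ↦ f a) are symmetric in all strands but the first: T preserves swaps away from
-- the last strand, and T² does not see the order of the last two strands.  Hence in
--   ψ_(m+1) (b,0^m,c) = p_(c+1) ψ_m (b,0^m) + ψ_m (b+c+1,0^m) + Σ_i ψ_m (b,0^m with c+1 added at i)
-- the last sum is m ψ_m (b,0^(m-1),c+1), and the recursion is solved by
-- ψ_(m+1) (b,0^m,c) = m! K_(m+1) (b,c).  Newton's identities enter only through
-- K_m (b,0) = m β_(m+1) (b), which puts ψ_m (b,0^m) = ψ_m (b,0^(m-1),0) in the same form.

open import Defs
open import Algebra.Bundles using (CommutativeRing)
open import Data.List using ([]; _∷_; _++_; _∷ʳ_; [_]; map; length; replicate; applyUpTo; initLast; _∷ʳ′_)
open import Data.List.Properties using (++-assoc; ∷ʳ-++; length-++-comm; ≡-dec)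
open import Data.Maybe using (just; nothing)
open import Data.Nat using (ℕ; zero; suc; _+_; _∸_; _≤_; _<_; _!; s≤s; z≤n)
import Data.Nat as ℕ
import Data.Nat.Properties as ℕₚ
open import Data.Nat.Tactic.RingSolver using (solve-∀)
open import Data.Product using (_,_)
open import Relation.Binary.PropositionalEquality as ≡ using (_≡_)
open import Relation.Nullary using (yes; no)
open import Tactic.RingSolver.Core.AlmostCommutativeRing using (fromCommutativeRing)

replicate-∷ʳ : ∀ {A : Set} r (x : A) → replicate (suc r) x ≡ replicate r x ∷ʳ x
replicate-∷ʳ zero x = ≡.refl
replicate-∷ʳ (suc r) x = ≡.cong (x ∷_) (replicate-∷ʳ r x)

module Trace {c ℓ} (R : CommutativeRing c ℓ) (h p : ℕ → CommutativeRing.Carrier R) where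
  open CommutativeRing R hiding (zero) renaming (_+_ to _+R_; _*_ to _*R_)
  open import Algebra.Properties.CommutativeSemigroup +-commutativeSemigroup
    using () renaming (interchange to +-interchange; x∙yz≈y∙xz to +-leftComm)
  open import Algebra.Properties.CommutativeSemigroup *-commutativeSemigroup
    using () renaming (x∙yz≈y∙xz to *-leftComm)
  open import Algebra.Properties.Semiring.Mult semiring using (_×_; ×-homo-+; ×1-homo-*)
  open import Relation.Binary.Reasoning.Setoid setoid
  open import Tactic.RingSolver.NonReflective (fromCommutativeRing R (λ _ → nothing))
    using (solve; _⊜_; _⊕_; _⊗_)
  open Sym R h p

  Σ< : ℕ → (ℕ → Carrier) → Carrier
  Σ< zero g = 0#
  Σ< (suc n) g = g 0 +R Σ< n (λ i → g (suc i))

  Σ<-cong-< : ∀ n {g g′ : ℕ → Carrier} → (∀ i → i < n → g i ≈ g′ i) → Σ< n g ≈ Σ< n g′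
  Σ<-cong-< zero eq = refl
  Σ<-cong-< (suc n) eq = +-cong (eq 0 (s≤s z≤n)) (Σ<-cong-< n (λ i i<n → eq (suc i) (s≤s i<n)))

  Σ<-cong : ∀ n {g g′ : ℕ → Carrier} → (∀ i → g i ≈ g′ i) → Σ< n g ≈ Σ< n g′
  Σ<-cong n eq = Σ<-cong-< n (λ i _ → eq i)

  Σ<-distrib-+ : ∀ n g g′ → Σ< n (λ i → g i +R g′ i) ≈ Σ< n g +R Σ< n g′
  Σ<-distrib-+ zero g g′ = sym (+-identityˡ 0#)
  Σ<-distrib-+ (suc n) g g′ = trans (+-congˡ (Σ<-distrib-+ n _ _)) (+-interchange _ _ _ _)

  *-distribˡ-Σ< : ∀ a n g → a *R Σ< n g ≈ Σ< n (λ i → a *R g i)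
  *-distribˡ-Σ< a zero g = zeroʳ a
  *-distribˡ-Σ< a (suc n) g = trans (distribˡ a _ _) (+-congˡ (*-distribˡ-Σ< a n _))

  *-distribʳ-Σ< : ∀ a n g → Σ< n g *R a ≈ Σ< n (λ i → g i *R a)
  *-distribʳ-Σ< a zero g = zeroˡ a
  *-distribʳ-Σ< a (suc n) g = trans (distribʳ a _ _) (+-congˡ (*-distribʳ-Σ< a n _))

  Σ<-init-last : ∀ n g → Σ< (suc n) g ≈ Σ< n g +R g n
  Σ<-init-last zero g = trans (+-identityʳ _) (sym (+-identityˡ _))
  Σ<-init-last (suc n) g = trans (+-congˡ (Σ<-init-last n _)) (sym (+-assoc _ _ _))

  ΣR-range : ∀ lo hi F → ΣR (range lo hi) F ≡ Σ< (suc hi ∸ lo) (λ i → F (lo + i))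
  ΣR-range lo hi F = go (suc hi ∸ lo) (λ i → i)
    where
    go : ∀ n G → ΣR (map (lo +_) (applyUpTo G n)) F ≡ Σ< n (λ i → F (lo + G i))
    go zero G = ≡.refl
    go (suc n) G = ≡.cong (F (lo + G 0) +R_) (go n (λ i → G (suc i)))

  natR≡×1# : ∀ m → natR m ≡ m × 1#
  natR≡×1# zero = ≡.refl
  natR≡×1# (suc m) = ≡.cong (1# +R_) (natR≡×1# m)

  natR-+ : ∀ m n → natR (m + n) ≈ natR m +R natR n
  natR-+ m n rewrite natR≡×1# (m + n) | natR≡×1# m | natR≡×1# n = ×-homo-+ 1# m n

  natR-* : ∀ m n → natR (m ℕ.* n) ≈ natR m *R natR n
  natR-* m n rewrite natR≡×1# (m ℕ.* n) | natR≡×1# m | natR≡×1# n = ×1-homo-* m n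

  natR-suc-* : ∀ n x → natR (suc n) *R x ≈ x +R natR n *R x
  natR-suc-* n x = trans (distribʳ x 1# (natR n)) (+-congʳ (*-identityˡ x))

  natR-1-* : ∀ x → natR 1 *R x ≈ x
  natR-1-* x = trans (natR-suc-* 0 x) (trans (+-congˡ (zeroˡ x)) (+-identityʳ x))

  natR-!-* : ∀ r x → natR (suc r) *R (natR (r !) *R x) ≈ natR (suc r !) *R x
  natR-!-* r x = trans (sym (*-assoc _ _ _)) (*-congʳ (sym (natR-* (suc r) (r !))))

  -- Functionals and the transposed trace

  Functional : Set c
  Functional = Crossing → Carrier

  ⟨_∣_⟩ : Functional → FS → Carrier
  ⟨ φ ∣ [] ⟩ = 0#
  ⟨ φ ∣ (r , D) ∷ x ⟩ = r *R φ D +R ⟨ φ ∣ x ⟩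

  ⟨⟩-++ : ∀ φ x y → ⟨ φ ∣ x ++ y ⟩ ≈ ⟨ φ ∣ x ⟩ +R ⟨ φ ∣ y ⟩
  ⟨⟩-++ φ [] y = sym (+-identityˡ _)
  ⟨⟩-++ φ ((r , D) ∷ x) y = trans (+-congˡ (⟨⟩-++ φ x y)) (sym (+-assoc _ _ _))

  ⟨⟩-scale : ∀ φ r x → ⟨ φ ∣ scale r x ⟩ ≈ r *R ⟨ φ ∣ x ⟩
  ⟨⟩-scale φ r [] = sym (zeroʳ r)
  ⟨⟩-scale φ r ((s , D) ∷ x) =
    trans (+-cong (*-assoc r s (φ D)) (⟨⟩-scale φ r x)) (sym (distribˡ r _ _))

  ⟨⟩-ΣFS : ∀ φ is g → ⟨ φ ∣ ΣFS is g ⟩ ≈ ΣR is (λ i → ⟨ φ ∣ g i ⟩)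
  ⟨⟩-ΣFS φ [] g = refl
  ⟨⟩-ΣFS φ (i ∷ is) g = trans (⟨⟩-++ φ (g i) (ΣFS is g)) (+-congˡ (⟨⟩-ΣFS φ is g))

  ⟨⟩-ΣFS-range : ∀ φ lo hi g → ⟨ φ ∣ ΣFS (range lo hi) g ⟩ ≈ Σ< (suc hi ∸ lo) (λ i → ⟨ φ ∣ g (lo + i) ⟩)
  ⟨⟩-ΣFS-range φ lo hi g = trans (⟨⟩-ΣFS φ (range lo hi) g) (reflexive (ΣR-range lo hi _))

  δ : Crossing → Functional
  δ E D with ≡-dec ℕₚ._≟_ D E
  ... | yes _ = 1#
  ... | no _ = 0#

  coeff≈⟨δ⟩ : ∀ x E → coeff x E ≈ ⟨ δ E ∣ x ⟩
  coeff≈⟨δ⟩ [] E = refl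
  coeff≈⟨δ⟩ ((r , D) ∷ x) E with ≡-dec ℕₚ._≟_ D E
  ... | yes _ = +-cong (sym (*-identityʳ r)) (coeff≈⟨δ⟩ x E)
  ... | no _ = trans (coeff≈⟨δ⟩ x E) (sym (trans (+-congʳ (zeroʳ r)) (+-identityˡ _)))

  T : Functional → Functional
  T φ D = ⟨ φ ∣ tr₁ D ⟩

  T^ : ℕ → Functional → Functional
  T^ zero φ = φ
  T^ (suc m) φ = T (T^ m φ)

  ⟨⟩-tr : ∀ φ x → ⟨ φ ∣ tr x ⟩ ≈ ⟨ T φ ∣ x ⟩
  ⟨⟩-tr φ [] = refl
  ⟨⟩-tr φ ((r , D) ∷ x) =
    trans (⟨⟩-++ φ (scale r (tr₁ D)) (tr x)) (+-cong (⟨⟩-scale φ r (tr₁ D)) (⟨⟩-tr φ x))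

  trIter-suc : ∀ m x → trIter (suc m) x ≡ trIter m (tr x)
  trIter-suc zero x = ≡.refl
  trIter-suc (suc m) x = ≡.cong tr (trIter-suc m x)

  ⟨⟩-trIter : ∀ m φ x → ⟨ φ ∣ trIter m x ⟩ ≈ ⟨ T^ m φ ∣ x ⟩
  ⟨⟩-trIter zero φ x = refl
  ⟨⟩-trIter (suc m) φ x rewrite trIter-suc m x =
    trans (⟨⟩-trIter m φ (tr x)) (⟨⟩-tr (T^ m φ) x)

  bumpSum : Functional → ℕ → Crossing → Carrier
  bumpSum g d [] = 0#
  bumpSum g d (x ∷ xs) = g (x + d ∷ xs) +R bumpSum (λ E → g (x ∷ E)) d xs

  ⟨⟩-bumps : ∀ g d L → ⟨ g ∣ map (λ E → (1# , E)) (bumps d L) ⟩ ≈ bumpSum g d L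
  ⟨⟩-bumps g d [] = refl
  ⟨⟩-bumps g d (x ∷ L) =
    +-cong (*-identityˡ _) (trans (reflexive (prefix g (bumps d L))) (⟨⟩-bumps (λ E → g (x ∷ E)) d L))
    where
    prefix : ∀ g Es →
      ⟨ g ∣ map (λ E → (1# , E)) (map (x ∷_) Es) ⟩ ≡ ⟨ (λ E → g (x ∷ E)) ∣ map (λ E → (1# , E)) Es ⟩
    prefix g [] = ≡.refl
    prefix g (E ∷ Es) = ≡.cong (1# *R g (x ∷ E) +R_) (prefix g Es)

  bumpSum-cong-length : ∀ {g g′} d L → (∀ E → length E ≡ length L → g E ≈ g′ E) → bumpSum g d L ≈ bumpSum g′ d L
  bumpSum-cong-length d [] eq = refl
  bumpSum-cong-length d (x ∷ L) eq =
    +-cong (eq _ ≡.refl) (bumpSum-cong-length d L (λ E len → eq (x ∷ E) (≡.cong suc len)))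

  bumpSum-cong : ∀ {g g′} d L → (∀ E → g E ≈ g′ E) → bumpSum g d L ≈ bumpSum g′ d L
  bumpSum-cong d L eq = bumpSum-cong-length d L (λ E _ → eq E)

  bumpSum-+ : ∀ g g′ d L → bumpSum (λ E → g E +R g′ E) d L ≈ bumpSum g d L +R bumpSum g′ d L
  bumpSum-+ g g′ d [] = sym (+-identityˡ 0#)
  bumpSum-+ g g′ d (x ∷ L) = trans (+-congˡ (bumpSum-+ _ _ d L)) (+-interchange _ _ _ _)

  bumpSum-* : ∀ a g d L → bumpSum (λ E → a *R g E) d L ≈ a *R bumpSum g d L
  bumpSum-* a g d [] = sym (zeroʳ a)
  bumpSum-* a g d (x ∷ L) = trans (+-congˡ (bumpSum-* a _ d L)) (sym (distribˡ a _ _))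

  bumpSum-0 : ∀ d L → bumpSum (λ _ → 0#) d L ≈ 0#
  bumpSum-0 d [] = refl
  bumpSum-0 d (x ∷ L) = trans (+-congˡ (bumpSum-0 d L)) (+-identityʳ 0#)

  bumpSum-∷ʳ : ∀ g d L u → bumpSum g d (L ∷ʳ u) ≈ bumpSum (λ E → g (E ∷ʳ u)) d L +R g (L ∷ʳ (u + d))
  bumpSum-∷ʳ g d [] u = trans (+-identityʳ _) (sym (+-identityˡ _))
  bumpSum-∷ʳ g d (x ∷ L) u =
    trans (+-congˡ (bumpSum-∷ʳ (λ E → g (x ∷ E)) d L u)) (sym (+-assoc _ _ _))

  bumpSum-comm : ∀ g d e L → bumpSum (λ E → bumpSum g e E) d L ≈ bumpSum (λ E → bumpSum g d E) e L
  bumpSum-comm g d e [] = refl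
  bumpSum-comm g d e (x ∷ L) = begin
      (g (x + d + e ∷ L) +R bumpSum (at (x + d)) e L) +R bumpSum (λ E → at (x + e) E +R bumpSum (at x) e E) d L
    ≈⟨ +-congˡ (bumpSum-+ (at (x + e)) _ d L) ⟩
      (g (x + d + e ∷ L) +R bumpSum (at (x + d)) e L) +R (bumpSum (at (x + e)) d L +R bumpSum (λ E → bumpSum (at x) e E) d L)
    ≈⟨ +-cong (+-congʳ (reflexive (≡.cong (λ y → g (y ∷ L)) (x+d+e≡x+e+d x d e)))) (+-congˡ (bumpSum-comm (at x) d e L)) ⟩
      (g (x + e + d ∷ L) +R bumpSum (at (x + d)) e L) +R (bumpSum (at (x + e)) d L +R bumpSum (λ E → bumpSum (at x) d E) e L)
    ≈⟨ +-interchange _ _ _ _ ⟩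
      (g (x + e + d ∷ L) +R bumpSum (at (x + e)) d L) +R (bumpSum (at (x + d)) e L +R bumpSum (λ E → bumpSum (at x) d E) e L)
    ≈⟨ +-congˡ (sym (bumpSum-+ (at (x + d)) _ e L)) ⟩
      (g (x + e + d ∷ L) +R bumpSum (at (x + e)) d L) +R bumpSum (λ E → at (x + d) E +R bumpSum (at x) d E) e L ∎
    where
    at : ℕ → Functional
    at y E = g (y ∷ E)
    x+d+e≡x+e+d : ∀ x d e → x + d + e ≡ x + e + d
    x+d+e≡x+e+d = solve-∀

  unsnoc-∷ʳ : ∀ xs a → unsnoc (xs ∷ʳ a) ≡ just (xs , a)
  unsnoc-∷ʳ [] a = ≡.refl
  unsnoc-∷ʳ (x ∷ []) a = ≡.refl
  unsnoc-∷ʳ (x ∷ y ∷ xs) a rewrite unsnoc-∷ʳ (y ∷ xs) a = ≡.refl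

  tr₁-∷ʳ : ∀ y ys a → tr₁ ((y ∷ ys) ∷ʳ a) ≡ (p (suc a) , y ∷ ys) ∷ map (λ E → (1# , E)) (bumps (suc a) (y ∷ ys))
  tr₁-∷ʳ y ys a rewrite unsnoc-∷ʳ (y ∷ ys) a = ≡.refl

  T-unfold : ∀ ψ y ys a → T ψ ((y ∷ ys) ∷ʳ a) ≈ p (suc a) *R ψ (y ∷ ys) +R bumpSum ψ (suc a) (y ∷ ys)
  T-unfold ψ y ys a rewrite tr₁-∷ʳ y ys a = +-congˡ (⟨⟩-bumps ψ (suc a) (y ∷ ys))

  T-unfold₀ : ∀ {ψ} → ψ [] ≈ 0# → ∀ L a → T ψ (L ∷ʳ a) ≈ p (suc a) *R ψ L +R bumpSum ψ (suc a) L
  T-unfold₀ ψ[]≈0 [] a = sym (trans (+-identityʳ _) (trans (*-congˡ ψ[]≈0) (zeroʳ _)))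
  T-unfold₀ {ψ} ψ[]≈0 (y ∷ ys) a = T-unfold ψ y ys a

  module _ {ψ : Functional} (ψ[]≈0 : ψ [] ≈ 0#) (L : Crossing) where
    private
      B : ℕ → Carrier
      B d = bumpSum ψ d L

      BB : ℕ → ℕ → Carrier
      BB d e = bumpSum (λ E → bumpSum ψ e E) d L

      C : ℕ → Carrier
      C w = p (suc w) *R ψ L +R B (suc w)

    T²-unfold : ∀ u v → T (T ψ) (L ∷ʳ u ∷ʳ v) ≈
      p (suc v) *R (p (suc u) *R ψ L +R B (suc u)) +R ((p (suc u) *R B (suc v) +R BB (suc v) (suc u)) +R C (u + suc v))
    T²-unfold u v = begin
        T (T ψ) (L ∷ʳ u ∷ʳ v)
      ≈⟨ T-unfold₀ refl (L ∷ʳ u) v ⟩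
        p (suc v) *R T ψ (L ∷ʳ u) +R bumpSum (T ψ) (suc v) (L ∷ʳ u)
      ≈⟨ +-cong (*-congˡ (T-unfold₀ ψ[]≈0 L u)) (bumpSum-∷ʳ (T ψ) (suc v) L u) ⟩
        p (suc v) *R (p (suc u) *R ψ L +R B (suc u)) +R
          (bumpSum (λ E → T ψ (E ∷ʳ u)) (suc v) L +R T ψ (L ∷ʳ (u + suc v)))
      ≈⟨ +-congˡ (+-cong inner (T-unfold₀ ψ[]≈0 L (u + suc v))) ⟩
        p (suc v) *R (p (suc u) *R ψ L +R B (suc u)) +R ((p (suc u) *R B (suc v) +R BB (suc v) (suc u)) +R C (u + suc v)) ∎
      where
      inner : bumpSum (λ E → T ψ (E ∷ʳ u)) (suc v) L ≈ p (suc u) *R B (suc v) +R BB (suc v) (suc u)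
      inner = trans (bumpSum-cong (suc v) L (λ E → T-unfold₀ ψ[]≈0 E u))
                (trans (bumpSum-+ _ _ (suc v) L) (+-congʳ (bumpSum-* (p (suc u)) ψ (suc v) L)))

    T²-swap-last : ∀ u v → T (T ψ) (L ∷ʳ u ∷ʳ v) ≈ T (T ψ) (L ∷ʳ v ∷ʳ u)
    T²-swap-last u v = begin
        T (T ψ) (L ∷ʳ u ∷ʳ v)
      ≈⟨ T²-unfold u v ⟩
        p (suc v) *R (p (suc u) *R ψ L +R B (suc u)) +R ((p (suc u) *R B (suc v) +R BB (suc v) (suc u)) +R C (u + suc v))
      ≈⟨ +-congˡ (+-cong (+-congˡ (bumpSum-comm ψ (suc v) (suc u) L)) (reflexive (≡.cong C (u+sv≡v+su u v)))) ⟩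
        p (suc v) *R (p (suc u) *R ψ L +R B (suc u)) +R ((p (suc u) *R B (suc v) +R BB (suc u) (suc v)) +R C (v + suc u))
      ≈⟨ solve 7 (λ pu pv X Bu Bv D W → ((pv ⊗ (pu ⊗ X ⊕ Bu)) ⊕ ((pu ⊗ Bv ⊕ D) ⊕ W)) ⊜
                                         ((pu ⊗ (pv ⊗ X ⊕ Bv)) ⊕ ((pv ⊗ Bu ⊕ D) ⊕ W))) refl
           (p (suc u)) (p (suc v)) (ψ L) (B (suc u)) (B (suc v)) (BB (suc u) (suc v)) (C (v + suc u)) ⟩
        p (suc u) *R (p (suc v) *R ψ L +R B (suc v)) +R ((p (suc v) *R B (suc u) +R BB (suc u) (suc v)) +R C (v + suc u))
      ≈⟨ sym (T²-unfold v u) ⟩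
        T (T ψ) (L ∷ʳ v ∷ʳ u) ∎
      where
      u+sv≡v+su : ∀ u v → u + suc v ≡ v + suc u
      u+sv≡v+su = solve-∀

  T-cong-length : ∀ {φ φ′} m → (∀ D → length D ≡ m → φ D ≈ φ′ D) →
    ∀ D → length D ≡ suc m → T φ D ≈ T φ′ D
  T-cong-length m eq D len with initLast D
  ... | [] ∷ʳ′ a = refl
  T-cong-length {φ} {φ′} m eq .((y ∷ ys) ∷ʳ a) len | (y ∷ ys) ∷ʳ′ a =
    trans (T-unfold φ y ys a)
      (trans (+-cong (*-congˡ (eq _ len′)) (bumpSum-cong-length (suc a) (y ∷ ys) (λ E lenE → eq E (≡.trans lenE len′))))
             (sym (T-unfold φ′ y ys a)))
    where
    len′ : length (y ∷ ys) ≡ m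
    len′ = ℕₚ.suc-injective (≡.trans (length-++-comm [ a ] (y ∷ ys)) len)

  T^-cong-length : ∀ k m {φ φ′} → (∀ D → length D ≡ m → φ D ≈ φ′ D) →
    ∀ D → length D ≡ k + m → T^ k φ D ≈ T^ k φ′ D
  T^-cong-length zero m eq = eq
  T^-cong-length (suc k) m eq = T-cong-length (k + m) (T^-cong-length k m eq)

  -- Symmetry in the strands after the first

  SwapInvariant : Functional → Set ℓ
  SwapInvariant g = ∀ xs u v ys → g (xs ++ u ∷ v ∷ ys) ≈ g (xs ++ v ∷ u ∷ ys)

  TailSymmetric : Functional → Set ℓ
  TailSymmetric ψ = ∀ b → SwapInvariant (λ E → ψ (b ∷ E))

  swap-to-end : ∀ g → SwapInvariant g → ∀ y xs → g (y ∷ xs) ≈ g (xs ∷ʳ y)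
  swap-to-end g swap y [] = refl
  swap-to-end g swap y (x ∷ xs) =
    trans (swap [] y x xs) (swap-to-end (λ E → g (x ∷ E)) (λ zs → swap (x ∷ zs)) y xs)

  bumpSum-swap : ∀ {g} d → SwapInvariant g → SwapInvariant (bumpSum g d)
  bumpSum-swap d swap [] u v ys =
    trans (+-cong (swap [] _ _ _) (+-cong (swap [] _ _ _) (bumpSum-cong d ys (swap [] u v))))
          (+-leftComm _ _ _)
  bumpSum-swap d swap (x ∷ xs) u v ys =
    +-cong (swap (x + d ∷ xs) u v ys) (bumpSum-swap d (λ zs → swap (x ∷ zs)) xs u v ys)

  bumpSum-replicate : ∀ g d x r → SwapInvariant g →
    bumpSum g d (replicate (suc r) x) ≈ natR (suc r) *R g (replicate r x ∷ʳ (x + d))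
  bumpSum-replicate g d x zero swap = trans (+-identityʳ _) (sym (natR-1-* _))
  bumpSum-replicate g d x (suc r) swap =
    trans (+-cong (swap-to-end g swap (x + d) (replicate (suc r) x))
                  (bumpSum-replicate (λ E → g (x ∷ E)) d x r (λ zs → swap (x ∷ zs))))
          (sym (natR-suc-* (suc r) _))

  tail-symmetric-∷ʳ : ∀ χ → (∀ a b → SwapInvariant (λ M → χ ((b ∷ M) ∷ʳ a))) →
    (∀ b L u v → χ ((b ∷ L) ∷ʳ u ∷ʳ v) ≈ χ ((b ∷ L) ∷ʳ v ∷ʳ u)) → TailSymmetric χ
  tail-symmetric-∷ʳ χ inner last b xs u v ys with initLast ys
  ... | [] = ≡.subst₂ (λ A B → χ (b ∷ A) ≈ χ (b ∷ B)) (∷ʳ-++ xs u [ v ]) (∷ʳ-++ xs v [ u ]) (last b xs u v)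
  ... | ys′ ∷ʳ′ a = ≡.subst₂ (λ A B → χ (b ∷ A) ≈ χ (b ∷ B))
                      (++-assoc xs (u ∷ v ∷ ys′) [ a ]) (++-assoc xs (v ∷ u ∷ ys′) [ a ]) (inner a b xs u v ys′)

  T-swap-inner : ∀ {ψ} → TailSymmetric ψ → ∀ a b → SwapInvariant (λ M → T ψ ((b ∷ M) ∷ʳ a))
  T-swap-inner {ψ} sym-ψ a b xs u v ys =
    trans (T-unfold ψ b _ a)
      (trans (+-cong (*-congˡ (sym-ψ b xs u v ys))
                     (+-cong (sym-ψ (b + suc a) xs u v ys) (bumpSum-swap (suc a) (sym-ψ b) xs u v ys)))
             (sym (T-unfold ψ b _ a)))

  T^-[] : ∀ {φ} → φ [] ≈ 0# → ∀ k → T^ k φ [] ≈ 0#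
  T^-[] φ[]≈0 zero = φ[]≈0
  T^-[] φ[]≈0 (suc k) = refl

  T^-tail-symmetric : ∀ {φ} → φ [] ≈ 0# → TailSymmetric φ → TailSymmetric (T φ) → ∀ k → TailSymmetric (T^ k φ)
  T^-tail-symmetric φ[]≈0 sym₀ sym₁ zero = sym₀
  T^-tail-symmetric φ[]≈0 sym₀ sym₁ (suc zero) = sym₁
  T^-tail-symmetric {φ} φ[]≈0 sym₀ sym₁ (suc (suc k)) =
    tail-symmetric-∷ʳ (T^ (suc (suc k)) φ) (T-swap-inner (T^-tail-symmetric φ[]≈0 sym₀ sym₁ (suc k)))
                      (λ b L → T²-swap-last (T^-[] φ[]≈0 k) (b ∷ L))

  strand : (ℕ → Carrier) → Functional
  strand f [] = 0#
  strand f (a ∷ []) = f a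
  strand f (a ∷ b ∷ D) = 0#

  δ≈strand : ∀ E D → length D ≡ 1 → δ E D ≈ strand (λ a → δ E (S a)) D
  δ≈strand E (a ∷ []) _ = refl

  strand-tail-symmetric : ∀ f → TailSymmetric (strand f)
  strand-tail-symmetric f b [] u v ys = refl
  strand-tail-symmetric f b (x ∷ xs) u v ys = refl

  T-strand-vanishes : ∀ f b L u v → T (strand f) ((b ∷ L) ∷ʳ u ∷ʳ v) ≈ 0#
  T-strand-vanishes f b L u v =
    trans (T-unfold (strand f) b (L ∷ʳ u) v)
      (trans (+-cong (*-congˡ (long b L)) (+-cong (long (b + suc v) L) (bumps-long L)))
             (trans (+-congʳ (zeroʳ _)) (trans (+-identityˡ _) (+-identityˡ 0#))))
    where
    long : ∀ x L → strand f (x ∷ L ∷ʳ u) ≈ 0#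
    long x [] = refl
    long x (y ∷ L) = refl
    bumps-long : ∀ L → bumpSum (λ E → strand f (b ∷ E)) (suc v) (L ∷ʳ u) ≈ 0#
    bumps-long [] = +-identityʳ 0#
    bumps-long (y ∷ L) = trans (+-identityˡ _) (bumpSum-0 (suc v) (L ∷ʳ u))

  T-strand-tail-symmetric : ∀ f → TailSymmetric (T (strand f))
  T-strand-tail-symmetric f =
    tail-symmetric-∷ʳ (T (strand f)) (T-swap-inner (strand-tail-symmetric f))
                      (λ b L u v → trans (T-strand-vanishes f b L u v) (sym (T-strand-vanishes f b L v u)))

  -- The closed form

  module ClosedForm (f : ℕ → Carrier) where
    β : ℕ → ℕ → Carrier
    β m b = Σ< m (λ i → h (m ∸ suc i) *R f (b + i))

    N : ℕ → ℕ → Carrier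
    N n c = Σ< n (λ l → h (n ∸ suc l) *R p (suc (c + l)))

    K₁ K₂ K : ℕ → ℕ → ℕ → Carrier
    K₁ m b c = Σ< m (λ t → natR (suc t) *R (h (m ∸ suc t) *R f (b + suc (c + t))))
    K₂ m b c = Σ< m (λ i → N (m ∸ i) c *R f (b + i))
    K m b c = K₁ m b c +R K₂ m b c

    β-1 : h 0 ≈ 1# → ∀ b → β 1 b ≈ f b
    β-1 h0 b = trans (+-identityʳ _) (trans (*-cong h0 (reflexive (≡.cong f (ℕₚ.+-identityʳ b)))) (*-identityˡ _))

    N-suc : ∀ n c → N (suc n) c ≈ h n *R p (suc c) +R N n (suc c)
    N-suc n c = +-cong (*-congˡ (reflexive (≡.cong (λ x → p (suc x)) (ℕₚ.+-identityʳ c))))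
                       (Σ<-cong n (λ l → *-congˡ (reflexive (≡.cong (λ x → p (suc x)) (ℕₚ.+-suc c l)))))

    N-newton : (∀ m → Newton (suc m)) → ∀ n → N n 0 ≈ natR n *R h n
    N-newton newton zero = sym (zeroˡ _)
    N-newton newton (suc m) =
      sym (trans (newton m) (trans (reflexive (ΣR-range 1 (suc m) (λ i → p i *R h (suc m ∸ i))))
                                    (Σ<-cong (suc m) (λ i → *-comm (p (suc i)) (h (m ∸ i))))))

    K₁-suc : ∀ m b c → K₁ (suc m) b c ≈ β (suc m) (b + suc c) +R K₁ m b (suc c)
    K₁-suc m b c = begin
        Σ< (suc m) (λ t → natR (suc t) *R X t)
      ≈⟨ trans (Σ<-cong (suc m) (λ t → natR-suc-* t (X t))) (Σ<-distrib-+ (suc m) X (λ t → natR t *R X t)) ⟩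
        Σ< (suc m) X +R (natR 0 *R X 0 +R Σ< m (λ t → natR (suc t) *R X (suc t)))
      ≈⟨ +-cong (Σ<-cong (suc m) {X} (λ t → *-congˡ (reflexive (≡.cong f (≡.sym (ℕₚ.+-assoc b (suc c) t))))))
                (trans (+-congʳ (zeroˡ _)) (trans (+-identityˡ _)
                  (Σ<-cong m {λ t → natR (suc t) *R X (suc t)}
                     (λ t → *-congˡ (*-congˡ (reflexive (≡.cong (λ x → f (b + suc x)) (ℕₚ.+-suc c t)))))))) ⟩
        β (suc m) (b + suc c) +R K₁ m b (suc c) ∎
      where
      X : ℕ → Carrier
      X t = h (m ∸ t) *R f (b + suc (c + t))

    K₂-suc : ∀ m b c → K₂ (suc m) b c ≈ p (suc c) *R β (suc m) b +R K₂ m b (suc c)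
    K₂-suc m b c = begin
        Σ< (suc m) (λ i → N (suc m ∸ i) c *R f (b + i))
      ≈⟨ Σ<-cong-< (suc m) split ⟩
        Σ< (suc m) (λ i → p (suc c) *R (h (m ∸ i) *R f (b + i)) +R N (m ∸ i) (suc c) *R f (b + i))
      ≈⟨ Σ<-distrib-+ (suc m) (λ i → p (suc c) *R (h (m ∸ i) *R f (b + i))) (λ i → N (m ∸ i) (suc c) *R f (b + i)) ⟩
        Σ< (suc m) (λ i → p (suc c) *R (h (m ∸ i) *R f (b + i))) +R Σ< (suc m) (λ i → N (m ∸ i) (suc c) *R f (b + i))
      ≈⟨ +-cong (sym (*-distribˡ-Σ< (p (suc c)) (suc m) (λ i → h (m ∸ i) *R f (b + i))))
                (trans (Σ<-init-last m (λ i → N (m ∸ i) (suc c) *R f (b + i))) (trans (+-congˡ last≈0) (+-identityʳ _))) ⟩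
        p (suc c) *R β (suc m) b +R K₂ m b (suc c) ∎
      where
      split : ∀ i → i < suc m →
        N (suc m ∸ i) c *R f (b + i) ≈ p (suc c) *R (h (m ∸ i) *R f (b + i)) +R N (m ∸ i) (suc c) *R f (b + i)
      split i (s≤s i≤m) = begin
          N (suc m ∸ i) c *R f (b + i)
        ≡⟨ ≡.cong (λ n → N n c *R f (b + i)) (ℕₚ.+-∸-assoc 1 i≤m) ⟩
          N (suc (m ∸ i)) c *R f (b + i)
        ≈⟨ trans (*-congʳ (N-suc (m ∸ i) c)) (distribʳ _ _ _) ⟩
          h (m ∸ i) *R p (suc c) *R f (b + i) +R N (m ∸ i) (suc c) *R f (b + i)
        ≈⟨ +-congʳ (trans (*-congʳ (*-comm _ _)) (*-assoc _ _ _)) ⟩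
          p (suc c) *R (h (m ∸ i) *R f (b + i)) +R N (m ∸ i) (suc c) *R f (b + i) ∎
      last≈0 : N (m ∸ m) (suc c) *R f (b + m) ≈ 0#
      last≈0 = trans (*-congʳ (reflexive (≡.cong (λ n → N n (suc c)) (ℕₚ.n∸n≡0 m)))) (zeroˡ _)

    K-suc : ∀ m b c → K (suc m) b c ≈ p (suc c) *R β (suc m) b +R (β (suc m) (b + suc c) +R K m b (suc c))
    K-suc m b c = trans (+-cong (K₁-suc m b c) (K₂-suc m b c))
      (solve 4 (λ x y z w → ((x ⊕ y) ⊕ (z ⊕ w)) ⊜ (z ⊕ (x ⊕ (y ⊕ w)))) refl _ _ _ _)

    K-zero : (∀ m → Newton (suc m)) → ∀ m b → K m b 0 ≈ natR m *R β (suc m) b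
    K-zero newton m b = begin
        K₁ m b 0 +R K₂ m b 0
      ≈⟨ +-cong (sym (trans (+-congʳ (zeroˡ _)) (+-identityˡ _))) K₂≈ ⟩
        Σ< (suc m) (λ i → natR i *R Y i) +R Σ< (suc m) (λ i → natR (m ∸ i) *R Y i)
      ≈⟨ sym (Σ<-distrib-+ (suc m) (λ i → natR i *R Y i) (λ i → natR (m ∸ i) *R Y i)) ⟩
        Σ< (suc m) (λ i → natR i *R Y i +R natR (m ∸ i) *R Y i)
      ≈⟨ Σ<-cong-< (suc m) (λ { i (s≤s i≤m) → trans (sym (distribʳ (Y i) (natR i) (natR (m ∸ i))))
                                (*-congʳ (trans (sym (natR-+ i (m ∸ i)))
                                                (reflexive (≡.cong natR (ℕₚ.m+[n∸m]≡n i≤m))))) }) ⟩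
        Σ< (suc m) (λ i → natR m *R Y i)
      ≈⟨ sym (*-distribˡ-Σ< (natR m) (suc m) Y) ⟩
        natR m *R β (suc m) b ∎
      where
      Y : ℕ → Carrier
      Y i = h (m ∸ i) *R f (b + i)
      K₂≈ : K₂ m b 0 ≈ Σ< (suc m) (λ i → natR (m ∸ i) *R Y i)
      K₂≈ = begin
          Σ< m (λ i → N (m ∸ i) 0 *R f (b + i))
        ≈⟨ Σ<-cong m (λ i → trans (*-congʳ (N-newton newton (m ∸ i))) (*-assoc _ _ _)) ⟩
          Σ< m (λ i → natR (m ∸ i) *R Y i)
        ≈⟨ sym (trans (Σ<-init-last m (λ i → natR (m ∸ i) *R Y i)) (trans (+-congˡ last≈0) (+-identityʳ _))) ⟩
          Σ< (suc m) (λ i → natR (m ∸ i) *R Y i) ∎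
        where
        last≈0 : natR (m ∸ m) *R Y m ≈ 0#
        last≈0 = trans (*-congʳ (reflexive (≡.cong natR (ℕₚ.n∸n≡0 m)))) (zeroˡ _)

  module Values (h0 : h 0 ≈ 1#) (newton : ∀ m → Newton (suc m)) (f : ℕ → Carrier) where
    open ClosedForm f

    ψ : ℕ → Functional
    ψ m = T^ m (strand f)

    ψ-tail-symmetric : ∀ m → TailSymmetric (ψ m)
    ψ-tail-symmetric = T^-tail-symmetric refl (strand-tail-symmetric f) (T-strand-tail-symmetric f)

    ψ-zeros : ∀ m b → ψ m (b ∷ replicate m 0) ≈ natR (m !) *R β (suc m) b
    ψ-zeros-∷ʳ : ∀ m b c → ψ (suc m) ((b ∷ replicate m 0) ∷ʳ c) ≈ natR (m !) *R K (suc m) b c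
    ψ-bumps : ∀ m b c → bumpSum (λ E → ψ m (b ∷ E)) (suc c) (replicate m 0) ≈ natR (m !) *R K m b (suc c)

    ψ-zeros zero b = sym (trans (natR-1-* _) (β-1 h0 b))
    ψ-zeros (suc r) b = begin
        ψ (suc r) (b ∷ replicate (suc r) 0)
      ≡⟨ ≡.cong (λ L → ψ (suc r) (b ∷ L)) (replicate-∷ʳ r 0) ⟩
        ψ (suc r) ((b ∷ replicate r 0) ∷ʳ 0)
      ≈⟨ ψ-zeros-∷ʳ r b 0 ⟩
        natR (r !) *R K (suc r) b 0
      ≈⟨ *-congˡ (K-zero newton (suc r) b) ⟩
        natR (r !) *R (natR (suc r) *R β (suc (suc r)) b)
      ≈⟨ *-leftComm _ _ _ ⟩
        natR (suc r) *R (natR (r !) *R β (suc (suc r)) b)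
      ≈⟨ natR-!-* r _ ⟩
        natR (suc r !) *R β (suc (suc r)) b ∎

    ψ-zeros-∷ʳ m b c = begin
        ψ (suc m) ((b ∷ Z) ∷ʳ c)
      ≈⟨ T-unfold (ψ m) b Z c ⟩
        p (suc c) *R ψ m (b ∷ Z) +R (ψ m (b + suc c ∷ Z) +R bumpSum (λ E → ψ m (b ∷ E)) (suc c) Z)
      ≈⟨ +-cong (*-congˡ (ψ-zeros m b)) (+-cong (ψ-zeros m (b + suc c)) (ψ-bumps m b c)) ⟩
        p (suc c) *R (F *R β (suc m) b) +R (F *R β (suc m) (b + suc c) +R F *R K m b (suc c))
      ≈⟨ solve 5 (λ P F X Y W → (P ⊗ (F ⊗ X) ⊕ (F ⊗ Y ⊕ F ⊗ W)) ⊜ (F ⊗ (P ⊗ X ⊕ (Y ⊕ W)))) refl _ _ _ _ _ ⟩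
        F *R (p (suc c) *R β (suc m) b +R (β (suc m) (b + suc c) +R K m b (suc c)))
      ≈⟨ *-congˡ (sym (K-suc m b c)) ⟩
        F *R K (suc m) b c ∎
      where
      Z = replicate m 0
      F = natR (m !)

    ψ-bumps zero b c = sym (trans (*-congˡ (+-identityʳ 0#)) (zeroʳ _))
    ψ-bumps (suc r) b c = begin
        bumpSum (λ E → ψ (suc r) (b ∷ E)) (suc c) (replicate (suc r) 0)
      ≈⟨ bumpSum-replicate (λ E → ψ (suc r) (b ∷ E)) (suc c) 0 r (ψ-tail-symmetric (suc r) b) ⟩
        natR (suc r) *R ψ (suc r) ((b ∷ replicate r 0) ∷ʳ suc c)
      ≈⟨ *-congˡ (ψ-zeros-∷ʳ r b (suc c)) ⟩
        natR (suc r) *R (natR (r !) *R K (suc r) b (suc c))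
      ≈⟨ natR-!-* r _ ⟩
        natR (suc r !) *R K (suc r) b (suc c) ∎

  bracket₁ bracket₂ bracket : ℕ → ℕ → FS
  bracket₁ n j = ΣFS (range 2 n) (λ i → (natR (i ∸ 1) *R h (n ∸ i) , S (i + j ∸ 1)) ∷ [])
  bracket₂ n j = ΣFS (range 1 (n ∸ 1)) (λ i →
                   ΣFS (range 1 (n ∸ i)) (λ l → (h (n ∸ l ∸ i) *R p (l + j) , S (i ∸ 1)) ∷ []))
  bracket n j = bracket₁ n j ++ bracket₂ n j

  ⟨⟩-RHS : ∀ φ n k →
    ⟨ φ ∣ RHS n k ⟩ ≈ Σ< (suc k) (λ j → h (k ∸ j) *R (natR ((n ∸ 2) !) *R ⟨ φ ∣ bracket n j ⟩))
  ⟨⟩-RHS φ n k = begin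
      ⟨ φ ∣ scale F (ΣFS (range 0 k) (λ j → scale (h (k ∸ j)) (bracket n j))) ⟩
    ≈⟨ ⟨⟩-scale φ F (ΣFS (range 0 k) (λ j → scale (h (k ∸ j)) (bracket n j))) ⟩
      F *R ⟨ φ ∣ ΣFS (range 0 k) (λ j → scale (h (k ∸ j)) (bracket n j)) ⟩
    ≈⟨ *-congˡ (⟨⟩-ΣFS-range φ 0 k (λ j → scale (h (k ∸ j)) (bracket n j))) ⟩
      F *R Σ< (suc k) (λ j → ⟨ φ ∣ scale (h (k ∸ j)) (bracket n j) ⟩)
    ≈⟨ *-distribˡ-Σ< F (suc k) (λ j → ⟨ φ ∣ scale (h (k ∸ j)) (bracket n j) ⟩) ⟩
      Σ< (suc k) (λ j → F *R ⟨ φ ∣ scale (h (k ∸ j)) (bracket n j) ⟩)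
    ≈⟨ Σ<-cong (suc k) (λ j → trans (*-congˡ (⟨⟩-scale φ (h (k ∸ j)) (bracket n j))) (*-leftComm F _ _)) ⟩
      Σ< (suc k) (λ j → h (k ∸ j) *R (F *R ⟨ φ ∣ bracket n j ⟩)) ∎
    where
    F = natR ((n ∸ 2) !)

  ⟨⟩-∂D : ∀ ψ n k → ⟨ ψ ∣ ∂D n k ⟩ ≈ Σ< (suc k) (λ j → h (k ∸ j) *R ψ (Dj n j))
  ⟨⟩-∂D ψ n k = trans (⟨⟩-ΣFS-range ψ 0 k (λ j → (h (k ∸ j) , Dj n j) ∷ []))
                      (Σ<-cong (suc k) (λ j → +-identityʳ (h (k ∸ j) *R ψ (Dj n j))))

  ⟨⟩-bracket : ∀ φ r j → ⟨ φ ∣ bracket (suc (suc r)) j ⟩ ≈ ClosedForm.K (λ a → φ (S a)) (suc r) 0 j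
  ⟨⟩-bracket φ r j = trans (⟨⟩-++ φ (bracket₁ n j) (bracket₂ n j)) (+-cong first second)
    where
    open ClosedForm (λ a → φ (S a))
    n = suc (suc r)
    first : ⟨ φ ∣ bracket₁ n j ⟩ ≈ K₁ (suc r) 0 j
    first = trans (⟨⟩-ΣFS-range φ 2 n (λ i → (natR (i ∸ 1) *R h (n ∸ i) , S (i + j ∸ 1)) ∷ []))
      (Σ<-cong (suc r) (λ t → trans (+-identityʳ _) (trans (*-assoc (natR (suc t)) (h (r ∸ t)) _)
        (*-congˡ (*-congˡ (reflexive (≡.cong (λ x → φ (S (suc x))) (ℕₚ.+-comm t j))))))))
    second : ⟨ φ ∣ bracket₂ n j ⟩ ≈ K₂ (suc r) 0 j
    second = trans (⟨⟩-ΣFS-range φ 1 (n ∸ 1) (λ i → ΣFS (range 1 (n ∸ i)) (term i))) (Σ<-cong (suc r) λ i →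
      trans (⟨⟩-ΣFS-range φ 1 (n ∸ suc i) (term (suc i)))
        (trans (Σ<-cong (suc r ∸ i) (λ l → trans (+-identityʳ _)
                  (*-congʳ (*-cong (reflexive (≡.cong h (∸-swap (suc r) i l)))
                                   (reflexive (≡.cong (λ x → p (suc x)) (ℕₚ.+-comm l j)))))))
               (sym (*-distribʳ-Σ< (φ (S i)) (suc r ∸ i) (λ l → h (suc r ∸ i ∸ suc l) *R p (suc (j + l)))))))
      where
      term : ℕ → ℕ → FS
      term i l = (h (n ∸ l ∸ i) *R p (l + j) , S (i ∸ 1)) ∷ []
      ∸-swap : ∀ m i l → m ∸ l ∸ suc i ≡ m ∸ i ∸ suc l
      ∸-swap m i l = ≡.trans (ℕₚ.∸-+-assoc m l (suc i))
        (≡.trans (≡.cong (m ∸_) (l+si≡i+sl l i)) (≡.sym (ℕₚ.∸-+-assoc m i (suc l))))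
        where
        l+si≡i+sl : ∀ l i → l + suc i ≡ i + suc l
        l+si≡i+sl = solve-∀

  Dj≡replicate-∷ʳ : ∀ r j → Dj (suc r) j ≡ replicate r 0 ∷ʳ j
  Dj≡replicate-∷ʳ zero j = ≡.refl
  Dj≡replicate-∷ʳ (suc r) j = ≡.cong (0 ∷_) (Dj≡replicate-∷ʳ r j)

  length-Dj : ∀ r j → length (Dj (suc r) j) ≡ suc r
  length-Dj zero j = ≡.refl
  length-Dj (suc r) j = ≡.cong suc (length-Dj r j)

  T^-δ-Dj : h 0 ≈ 1# → (∀ m → Newton (suc m)) → ∀ r j E →
    T^ (suc r) (δ E) (Dj (suc (suc r)) j) ≈ natR (r !) *R ⟨ δ E ∣ bracket (suc (suc r)) j ⟩
  T^-δ-Dj h0 newton r j E = begin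
      T^ (suc r) (δ E) (Dj n j)
    ≈⟨ T^-cong-length (suc r) 1 (δ≈strand E) (Dj n j) (≡.trans (length-Dj (suc r) j) (ℕₚ.+-comm 1 (suc r))) ⟩
      ψ (suc r) (Dj n j)
    ≡⟨ ≡.cong (ψ (suc r)) (Dj≡replicate-∷ʳ (suc r) j) ⟩
      ψ (suc r) ((0 ∷ replicate r 0) ∷ʳ j)
    ≈⟨ ψ-zeros-∷ʳ r 0 j ⟩
      natR (r !) *R K (suc r) 0 j
    ≈⟨ *-congˡ (sym (⟨⟩-bracket (δ E) r j)) ⟩
      natR (r !) *R ⟨ δ E ∣ bracket n j ⟩ ∎
    where
    n = suc (suc r)
    open Values h0 newton (λ a → δ E (S a))
    open ClosedForm (λ a → δ E (S a))

proposition4p3 : ∀ {c ℓ} (R : CommutativeRing c ℓ)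
    (h p : ℕ → CommutativeRing.Carrier R) →
    CommutativeRing._≈_ R (h 0) (CommutativeRing.1# R) →
    (∀ m → Sym.Newton R h p (suc m)) →
    (n k : ℕ) → 2 ≤ n →
    Sym._≋_ R h p (Sym.trIter R h p (n ∸ 1) (Sym.∂D R h p n k)) (Sym.RHS R h p n k)
proposition4p3 R h p h0 newton (suc (suc r)) k (s≤s (s≤s _)) E = begin
    coeff (trIter (suc r) (∂D n k)) E
  ≈⟨ coeff≈⟨δ⟩ (trIter (suc r) (∂D n k)) E ⟩
    ⟨ δ E ∣ trIter (suc r) (∂D n k) ⟩
  ≈⟨ ⟨⟩-trIter (suc r) (δ E) (∂D n k) ⟩
    ⟨ T^ (suc r) (δ E) ∣ ∂D n k ⟩
  ≈⟨ ⟨⟩-∂D (T^ (suc r) (δ E)) n k ⟩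
    Σ< (suc k) (λ j → h (k ∸ j) *R T^ (suc r) (δ E) (Dj n j))
  ≈⟨ Σ<-cong (suc k) (λ j → *-congˡ {h (k ∸ j)} (T^-δ-Dj h0 newton r j E)) ⟩
    Σ< (suc k) (λ j → h (k ∸ j) *R (natR (r !) *R ⟨ δ E ∣ bracket n j ⟩))
  ≈⟨ sym (⟨⟩-RHS (δ E) n k) ⟩
    ⟨ δ E ∣ RHS n k ⟩
  ≈⟨ sym (coeff≈⟨δ⟩ (RHS n k) E) ⟩
    coeff (RHS n k) E ∎
  where
  n = suc (suc r)
  open CommutativeRing R using (sym; setoid; *-congˡ) renaming (_*_ to _*R_)
  open import Relation.Binary.Reasoning.Setoid setoid
  open Sym R h p
  open Trace R h p
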